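{- Let $A$ be a $\{ -,\triangleright\}$-algebra satisfying (Ax.1)–(Ax.5). Then for all $a,b,c,d\in A$: (i) $b\triangleright a\le a$; (ii) $a\triangleright(b\triangleright c)=(a\triangleright b)\triangleright c$; (iii) $(a\triangleright b)\triangleright(a\cdot b)=a\cdot b$; (iv) $a\triangleright(b\cdot c)=(a\triangleright b)\cdot c$; (v) $(a\triangleright b)-c=a\triangleright(b-c)$; (vi) if $a\le b$ and $c\le d$ then $a\triangleright c\le b\triangleright d$.
   Context: A $\{ -,\triangleright\}$-algebra is a set $A$ with binary operations $-,\triangleright$. Write $a\cdot b:=a-(a-b)$. Axioms: (Ax.1) $a-(b-a)=a$; (Ax.2) $a\cdot b=b\cdot a$; (Ax.3) $(a-b)-c=(a-c)-b$; (Ax.4) $(a\triangleright c)\cdot(b\triangleright c)=(a\triangleright b)\triangleright c$; (Ax.5) $(a\cdot b)\triangleright a=a\cdot b$. The order is $a\le b\iff a\cdot b=a$ (a meet-semilattice order). -}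

module Defs where

open import Level using (Level; suc)
open import Relation.Binary.PropositionalEquality using (_≡_)
open import Data.Product using (_×_)

record MinusTriAlgebra (ℓ : Level) : Set (suc ℓ) where
  infixl 6 _−_
  infixl 5 _▷_
  infixl 7 _·_
  field
    Carrier : Set ℓ
    _−_ : Carrier → Carrier → Carrier
    _▷_ : Carrier → Carrier → Carrier

  _·_ : Carrier → Carrier → Carrier
  a · b = a − (a − b)

  _≤_ : Carrier → Carrier → Set ℓ
  a ≤ b = a · b ≡ a

  field
    ax1 : ∀ a b → a − (b − a) ≡ a
    ax2 : ∀ a b → a · b ≡ b · a
    ax3 : ∀ a b c → (a − b) − c ≡ (a − c) − b
    ax4 : ∀ a b c → (a ▷ c) · (b ▷ c) ≡ (a ▷ b) ▷ c
    ax5 : ∀ a b → (a · b) ▷ a ≡ a · b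

{-# OPTIONS --safe #-}
module Submission where

-- The axioms (Ax.1)–(Ax.3) make (A, −) a subtraction algebra: ≤ is a
-- meet-semilattice order with meet ·, and p ≤ b gives p − c = p · (b − c).
-- Together with a ▷ a = a, (Ax.4) shows b ▷ a ≤ a, and then (Ax.4)–(Ax.5)
-- yield the rule  z ▷ x = (z ▷ y) · x  whenever x ≤ y, from which every item
-- follows by choosing y suitably.

open import Defs
open import Level using (Level)
open import Relation.Binary.PropositionalEquality
  using (_≡_; sym; trans; cong; cong₂; subst; module ≡-Reasoning)
open import Data.Product using (_×_; _,_)

record SubtractionAlgebra (ℓ : Level) : Set (Level.suc ℓ) where
  infixl 6 _−_
  infixl 7 _·_
  infix 4 _≤_
  field
    Carrier : Set ℓ
    _−_ : Carrier → Carrier → Carrier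

  _·_ : Carrier → Carrier → Carrier
  x · y = x − (x − y)

  _≤_ : Carrier → Carrier → Set ℓ
  x ≤ y = x · y ≡ x

  field
    −-absorb : ∀ x y → x − (y − x) ≡ x
    ·-comm : ∀ x y → x · y ≡ y · x
    −-exchange : ∀ x y z → x − y − z ≡ x − z − y

subtractionAlgebra : ∀ {ℓ} → MinusTriAlgebra ℓ → SubtractionAlgebra ℓ
subtractionAlgebra A = record
  { Carrier = Carrier ; _−_ = _−_ ; −-absorb = ax1 ; ·-comm = ax2 ; −-exchange = ax3 }
  where open MinusTriAlgebra A

-- x − x is the least element; it is written x − x since the carrier may be empty.
module SubtractionAlgebraProperties {ℓ} (S : SubtractionAlgebra ℓ) where
  open SubtractionAlgebra S
  open ≡-Reasoning

  x−y−y≡x−y : ∀ x y → x − y − y ≡ x − y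
  x−y−y≡x−y x y = begin
    x − y − y             ≡⟨ cong (x − y −_) (sym (−-absorb y x)) ⟩
    x − y − (y − (x − y)) ≡⟨ −-absorb (x − y) y ⟩
    x − y                 ∎

  private
    y−y≡[x−y]−[x−y] : ∀ x y → y − y ≡ (x − y) − (x − y)
    y−y≡[x−y]−[x−y] x y = begin
      y − y             ≡⟨ cong (y −_) (sym (−-absorb y x)) ⟩
      y · (x − y)       ≡⟨ ·-comm y (x − y) ⟩
      (x − y) · y       ≡⟨ cong (x − y −_) (x−y−y≡x−y x y) ⟩
      (x − y) − (x − y) ∎

  x−x≡y−y : ∀ x y → x − x ≡ y − y
  x−x≡y−y x y = begin
    x − x                                 ≡⟨ y−y≡[x−y]−[x−y] (x − y) x ⟩
    (x − y − x) − (x − y − x)             ≡⟨ cong₂ _−_ (−-exchange x y x) (−-exchange x y x) ⟩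
    (x − x − y) − (x − x − y)             ≡⟨ sym (y−y≡[x−y]−[x−y] (x − x) y) ⟩
    y − y                                 ∎

  x−x−y≡x−x : ∀ x y → x − x − y ≡ x − x
  x−x−y≡x−x x y = begin
    x − x − y ≡⟨ cong (_− y) (x−x≡y−y x y) ⟩
    y − y − y ≡⟨ x−y−y≡x−y y y ⟩
    y − y     ≡⟨ x−x≡y−y y x ⟩
    x − x     ∎

  ·-idem : ∀ x → x · x ≡ x
  ·-idem x = −-absorb x x

  x≤y⇒x−y≡x−x : ∀ {x y} → x ≤ y → x − y ≡ x − x
  x≤y⇒x−y≡x−x {x} {y} x≤y = begin
    x − y           ≡⟨ cong (_− y) (sym x≤y) ⟩
    x − (x − y) − y ≡⟨ −-exchange x (x − y) y ⟩
    x − y − (x − y) ≡⟨ x−x≡y−y (x − y) x ⟩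
    x − x           ∎

  x−y≡x−x⇒x≤y : ∀ {x y} → x − y ≡ x − x → x ≤ y
  x−y≡x−x⇒x≤y {x} x−y≡x−x = trans (cong (x −_) x−y≡x−x) (·-idem x)

  ≤-antisym : ∀ {x y} → x ≤ y → y ≤ x → x ≡ y
  ≤-antisym {x} {y} x≤y y≤x = trans (sym x≤y) (trans (·-comm x y) y≤x)

  x−z≡y−z−[y−x] : ∀ {x y} z → x ≤ y → x − z ≡ y − z − (y − x)
  x−z≡y−z−[y−x] {x} {y} z x≤y = begin
    x − z           ≡⟨ cong (_− z) (trans (sym x≤y) (·-comm x y)) ⟩
    y · x − z       ≡⟨ −-exchange y (y − x) z ⟩
    y − z − (y − x) ∎

  ≤-trans : ∀ {x y z} → x ≤ y → y ≤ z → x ≤ z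
  ≤-trans {x} {y} {z} x≤y y≤z = x−y≡x−x⇒x≤y (begin
    x − z           ≡⟨ x−z≡y−z−[y−x] z x≤y ⟩
    y − z − (y − x) ≡⟨ cong (_− (y − x)) (x≤y⇒x−y≡x−x y≤z) ⟩
    y − y − (y − x) ≡⟨ x−x−y≡x−x y (y − x) ⟩
    y − y           ≡⟨ x−x≡y−y y x ⟩
    x − x           ∎)

  x−y≤x : ∀ x y → x − y ≤ x
  x−y≤x x y = x−y≡x−x⇒x≤y (begin
    x − y − x ≡⟨ −-exchange x y x ⟩
    x − x − y ≡⟨ x−x−y≡x−x x y ⟩
    x − x     ≡⟨ x−x≡y−y x (x − y) ⟩
    x − y − (x − y) ∎)

  x·y≤x : ∀ x y → x · y ≤ x
  x·y≤x x y = x−y≤x x (x − y)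

  x·y≤y : ∀ x y → x · y ≤ y
  x·y≤y x y = subst (_≤ y) (·-comm y x) (x·y≤x y x)

  −-monoˡ-≤ : ∀ {x y} z → x ≤ y → x − z ≤ y − z
  −-monoˡ-≤ {x} {y} z x≤y = x−y≡x−x⇒x≤y (begin
    x − z − (y − z)                 ≡⟨ cong (_− (y − z)) (x−z≡y−z−[y−x] z x≤y) ⟩
    y − z − (y − x) − (y − z)       ≡⟨ −-exchange (y − z) (y − x) (y − z) ⟩
    y − z − (y − z) − (y − x)       ≡⟨ x−x−y≡x−x (y − z) (y − x) ⟩
    y − z − (y − z)                 ≡⟨ x−x≡y−y (y − z) (x − z) ⟩
    x − z − (x − z)                 ∎)

  −-monoʳ-≤ : ∀ {x y} z → x ≤ y → z − y ≤ z − x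
  −-monoʳ-≤ {x} {y} z x≤y = x−y≡x−x⇒x≤y (begin
    z − y − (z − x)     ≡⟨ −-exchange z y (z − x) ⟩
    z · x − y           ≡⟨ cong (_− y) (·-comm z x) ⟩
    x − (x − z) − y     ≡⟨ −-exchange x (x − z) y ⟩
    x − y − (x − z)     ≡⟨ cong (_− (x − z)) (x≤y⇒x−y≡x−x x≤y) ⟩
    x − x − (x − z)     ≡⟨ x−x−y≡x−x x (x − z) ⟩
    x − x               ≡⟨ x−x≡y−y x (z − y) ⟩
    z − y − (z − y)     ∎)

  ·-greatest : ∀ {x y z} → z ≤ x → z ≤ y → z ≤ x · y
  ·-greatest {x} {y} {z} z≤x z≤y = subst (_≤ x · y) x·z≡z
    (−-monoʳ-≤ x (−-monoʳ-≤ x z≤y))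
    where
    x·z≡z : x · z ≡ z
    x·z≡z = trans (·-comm x z) z≤x

  ·-assoc : ∀ x y z → x · y · z ≡ x · (y · z)
  ·-assoc x y z = ≤-antisym
    (·-greatest (≤-trans (x·y≤x _ _) (x·y≤x _ _))
                (·-greatest (≤-trans (x·y≤x _ _) (x·y≤y _ _)) (x·y≤y _ _)))
    (·-greatest (·-greatest (x·y≤x _ _) (≤-trans (x·y≤y _ _) (x·y≤x _ _)))
                (≤-trans (x·y≤y _ _) (x·y≤y _ _)))

  x≤y⇒x−[z−y]≡x : ∀ {x y} z → x ≤ y → x − (z − y) ≡ x
  x≤y⇒x−[z−y]≡x {x} {y} z x≤y = begin
    x − (z − y)                 ≡⟨ x−z≡y−z−[y−x] (z − y) x≤y ⟩
    y − (z − y) − (y − x)       ≡⟨ cong (_− (y − x)) (−-absorb y z) ⟩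
    y · x                       ≡⟨ ·-comm y x ⟩
    x · y                       ≡⟨ x≤y ⟩
    x                           ∎

  x≤y⇒x−z≡x·[y−z] : ∀ {x y} z → x ≤ y → x − z ≡ x · (y − z)
  x≤y⇒x−z≡x·[y−z] {x} {y} z x≤y =
    ≤-antisym (·-greatest (x−y≤x x z) (−-monoˡ-≤ z x≤y)) x·[y−z]≤x−z
    where
    x·z≤x−[y−z] : x · z ≤ x − (y − z)
    x·z≤x−[y−z] = subst (_≤ x − (y − z)) (x≤y⇒x−[z−y]≡x y (x·y≤y x z))
      (−-monoˡ-≤ (y − z) (x·y≤x x z))

    x·[y−z]≤x−z : x · (y − z) ≤ x − z
    x·[y−z]≤x−z = x−y≡x−x⇒x≤y (begin
      x · (y − z) − (x − z)               ≡⟨ x−z≡y−z−[y−x] (x − z) (x·y≤x x (y − z)) ⟩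
      x · z − (x − x · (y − z))           ≡⟨ x≤y⇒x−y≡x−x (≤-trans x·z≤x−[y−z] (−-monoʳ-≤ x (x·y≤y x (y − z)))) ⟩
      x · z − x · z                       ≡⟨ x−x≡y−y (x · z) (x · (y − z)) ⟩
      x · (y − z) − x · (y − z)           ∎)

module MinusTriAlgebraProperties {ℓ} (A : MinusTriAlgebra ℓ) where
  open MinusTriAlgebra A
  open SubtractionAlgebraProperties (subtractionAlgebra A)
  open ≡-Reasoning

  ▷-idem : ∀ x → x ▷ x ≡ x
  ▷-idem x = trans (cong (_▷ x) (sym (·-idem x))) (trans (ax5 x x) (·-idem x))

  x≤y⇒x▷y≡x : ∀ {x y} → x ≤ y → x ▷ y ≡ x
  x≤y⇒x▷y≡x {x} {y} x≤y = begin
    x ▷ y       ≡⟨ cong (_▷ y) (trans (sym x≤y) (ax2 x y)) ⟩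
    (y · x) ▷ y ≡⟨ ax5 y x ⟩
    y · x       ≡⟨ ax2 y x ⟩
    x · y       ≡⟨ x≤y ⟩
    x           ∎

  y▷x≤x : ∀ x y → (y ▷ x) ≤ x
  y▷x≤x x y = begin
    u · x             ≡⟨ sym (ax5 u x) ⟩
    (u · x) ▷ u       ≡⟨ cong (_▷ u) (sym u▷x≡u·x) ⟩
    (u ▷ x) ▷ u       ≡⟨ sym (ax4 u x u) ⟩
    (u ▷ u) · (x ▷ u) ≡⟨ cong (_· (x ▷ u)) (▷-idem u) ⟩
    u · (x ▷ u)       ≡⟨ u≤x▷u ⟩
    u                 ∎
    where
    u = y ▷ x

    u▷x≡u·x : u ▷ x ≡ u · x
    u▷x≡u·x = trans (sym (ax4 y x x)) (cong (u ·_) (▷-idem x))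

    u≤x▷u : u ≤ (x ▷ u)
    u≤x▷u = subst (_≤ (x ▷ u)) (trans (ax4 y x u) (▷-idem u)) (x·y≤y (y ▷ u) (x ▷ u))

  x≤y⇒z▷x≡[z▷y]·x : ∀ {x y} z → x ≤ y → z ▷ x ≡ (z ▷ y) · x
  x≤y⇒z▷x≡[z▷y]·x {x} {y} z x≤y = sym (begin
    (z ▷ y) · x       ≡⟨ cong ((z ▷ y) ·_) (sym (x≤y⇒x▷y≡x x≤y)) ⟩
    (z ▷ y) · (x ▷ y) ≡⟨ ax4 z x y ⟩
    (z ▷ x) ▷ y       ≡⟨ x≤y⇒x▷y≡x (≤-trans (y▷x≤x x z) x≤y) ⟩
    z ▷ x             ∎)

  x≤y⇒y▷x≡x : ∀ {x y} → x ≤ y → y ▷ x ≡ x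
  x≤y⇒y▷x≡x {x} {y} x≤y = begin
    y ▷ x       ≡⟨ x≤y⇒z▷x≡[z▷y]·x y x≤y ⟩
    (y ▷ y) · x ≡⟨ cong (_· x) (▷-idem y) ⟩
    y · x       ≡⟨ ax2 y x ⟩
    x · y       ≡⟨ x≤y ⟩
    x           ∎

  ▷-assoc : ∀ x y z → x ▷ (y ▷ z) ≡ (x ▷ y) ▷ z
  ▷-assoc x y z = trans (x≤y⇒z▷x≡[z▷y]·x x (y▷x≤x z y)) (ax4 x y z)

  [x▷y]▷[x·y]≡x·y : ∀ x y → (x ▷ y) ▷ (x · y) ≡ x · y
  [x▷y]▷[x·y]≡x·y x y = begin
    (x ▷ y) ▷ (x · y)                 ≡⟨ sym (ax4 x y (x · y)) ⟩
    (x ▷ (x · y)) · (y ▷ (x · y))     ≡⟨ cong₂ _·_ (x≤y⇒y▷x≡x (x·y≤x x y)) (x≤y⇒y▷x≡x (x·y≤y x y)) ⟩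
    (x · y) · (x · y)                 ≡⟨ ·-idem (x · y) ⟩
    x · y                             ∎

  x▷[y·z]≡[x▷y]·z : ∀ x y z → x ▷ (y · z) ≡ (x ▷ y) · z
  x▷[y·z]≡[x▷y]·z x y z = begin
    x ▷ (y · z)       ≡⟨ x≤y⇒z▷x≡[z▷y]·x x (x·y≤x y z) ⟩
    (x ▷ y) · (y · z) ≡⟨ sym (·-assoc (x ▷ y) y z) ⟩
    (x ▷ y) · y · z   ≡⟨ cong (_· z) (y▷x≤x y x) ⟩
    (x ▷ y) · z       ∎

  [x▷y]−z≡x▷[y−z] : ∀ x y z → (x ▷ y) − z ≡ x ▷ (y − z)
  [x▷y]−z≡x▷[y−z] x y z = begin
    (x ▷ y) − z       ≡⟨ x≤y⇒x−z≡x·[y−z] z (y▷x≤x y x) ⟩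
    (x ▷ y) · (y − z) ≡⟨ sym (x≤y⇒z▷x≡[z▷y]·x x (x−y≤x y z)) ⟩
    x ▷ (y − z)       ∎

  ▷-monoˡ-≤ : ∀ {x y} z → x ≤ y → (x ▷ z) ≤ (y ▷ z)
  ▷-monoˡ-≤ {x} {y} z x≤y = trans (ax4 x y z) (cong (_▷ z) (x≤y⇒x▷y≡x x≤y))

  ▷-monoʳ-≤ : ∀ {x y} z → x ≤ y → (z ▷ x) ≤ (z ▷ y)
  ▷-monoʳ-≤ {x} {y} z x≤y =
    subst (_≤ (z ▷ y)) (sym (x≤y⇒z▷x≡[z▷y]·x z x≤y)) (x·y≤x (z ▷ y) x)

  ▷-mono-≤ : ∀ {w x y z} → w ≤ x → y ≤ z → (w ▷ y) ≤ (x ▷ z)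
  ▷-mono-≤ {x = x} {y} w≤x y≤z = ≤-trans (▷-monoˡ-≤ y w≤x) (▷-monoʳ-≤ x y≤z)

proposition2p5 : ∀ {ℓ} (A : MinusTriAlgebra ℓ) → let open MinusTriAlgebra A in
    (∀ a b → (b ▷ a) ≤ a)
    × (∀ a b c → a ▷ (b ▷ c) ≡ (a ▷ b) ▷ c)
    × (∀ a b → (a ▷ b) ▷ (a · b) ≡ a · b)
    × (∀ a b c → a ▷ (b · c) ≡ (a ▷ b) · c)
    × (∀ a b c → (a ▷ b) − c ≡ a ▷ (b − c))
    × (∀ a b c d → a ≤ b → c ≤ d → (a ▷ c) ≤ (b ▷ d))
proposition2p5 A =
    y▷x≤x
  , ▷-assoc
  , [x▷y]▷[x·y]≡x·y
  , x▷[y·z]≡[x▷y]·z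
  , [x▷y]−z≡x▷[y−z]
  , λ _ _ _ _ → ▷-mono-≤
  where open MinusTriAlgebraProperties A
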